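{- Let $D$ be a $\langle 2,2\rangle$ digraph and let $u$ be a vertex of degree $2$ in $CCE(D)$. Then (i) $d^+(u)=d^-(u)=2$ in $D$; and (ii) if $v$ is a neighbor of $u$ in $CCE(D)$, then $u$ and $v$ have exactly one common prey and exactly one common predator in $D$.
   Context: All graphs and digraphs are simple (no loops, no multiple arcs). In a digraph $D$, if $(u,x)$ is an arc then $x$ is a prey of $u$ and $u$ is a predator of $x$; $d^+$ and $d^-$ denote outdegree and indegree. The CCE graph $CCE(D)$ of $D$ is the graph on $V(D)$ in which distinct $u,v$ are adjacent iff they have a common prey and a common predator in $D$. A $\langle 2,2\rangle$ digraph is a digraph in which every vertex has indegree at most $2$ and outdegree at most $2$. -}

module Defs where

open import Data.Nat using (ℕ; _≤_; _≤?_)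
open import Data.Product using (_×_)
open import Data.Fin using (Fin)
open import Data.Bool using (Bool; true; false; _∧_; if_then_else_)
open import Data.List using (List; length; filterᵇ; allFin)
open import Relation.Binary.PropositionalEquality using (_≡_; _≢_)
open import Relation.Nullary using (¬_)
open import Relation.Nullary.Decidable using (⌊_⌋)
open import Data.Fin using (_≟_)

-- Simple: no loops; multiple arcs are impossible in this representation
-- (antiparallel arcs (u,x),(x,u) are allowed, as in the paper's setting).
record Digraph (n : ℕ) : Set where
  field
    arc     : Fin n → Fin n → Bool
    loopless : ∀ v → arc v v ≡ false
open Digraph public

count : ∀ {n} → (Fin n → Bool) → ℕ
count {n} p = length (filterᵇ p (allFin n))

outdeg : ∀ {n} → Digraph n → Fin n → ℕ
outdeg D u = count (λ x → arc D u x)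

indeg : ∀ {n} → Digraph n → Fin n → ℕ
indeg D u = count (λ x → arc D x u)

Is22 : ∀ {n} → Digraph n → Set
Is22 {n} D = ∀ v → outdeg D v ≤ 2 × indeg D v ≤ 2

commonPrey : ∀ {n} → Digraph n → Fin n → Fin n → Fin n → Bool
commonPrey D u v x = arc D u x ∧ arc D v x

commonPred : ∀ {n} → Digraph n → Fin n → Fin n → Fin n → Bool
commonPred D u v x = arc D x u ∧ arc D x v

numCommonPrey : ∀ {n} → Digraph n → Fin n → Fin n → ℕ
numCommonPrey D u v = count (commonPrey D u v)

numCommonPred : ∀ {n} → Digraph n → Fin n → Fin n → ℕ
numCommonPred D u v = count (commonPred D u v)

cceAdj : ∀ {n} → Digraph n → Fin n → Fin n → Bool
cceAdj D u v = if ⌊ u ≟ v ⌋ then false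
               else (⌊ 1 ≤? numCommonPrey D u v ⌋ ∧ ⌊ 1 ≤? numCommonPred D u v ⌋)

cceDeg : ∀ {n} → Digraph n → Fin n → ℕ
cceDeg D u = count (cceAdj D u)

-- If w is a second CCE-neighbour of u, then a common prey of u
-- and v differs from a common prey of u and w, as otherwise it would have the
-- three predators u, v, w. So u has two preys, and a second common prey of u
-- and v would be a third one. Reversing all arcs gives the predator side.
module Submission where

open import Defs
open import Data.Nat using (ℕ; zero; suc; _≤_; _<_; z≤n; s≤s; _≤?_)
open import Data.Nat.Properties using (≤-antisym; <⇒≤; ≤⇒≯; ≮⇒≥)
open import Data.Fin using (Fin; zero; suc; _≟_)
open import Data.Product using (_×_; _,_; ∃; proj₁; proj₂; swap; map)
open import Data.Bool using (Bool; true; false; if_then_else_)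
open import Data.Bool.Properties using (if-float; ∧-conicalˡ; ∧-conicalʳ)
open import Data.List using (length; filterᵇ; tabulate)
open import Data.Empty using (⊥)
open import Function using (_∘_)
open import Relation.Nullary using (¬_; does; yes; no; contradiction)
open import Relation.Binary.PropositionalEquality
  using (_≡_; _≢_; refl; sym; trans; cong; subst; module ≡-Reasoning)

private
  variable
    n : ℕ

length-filterᵇ-tabulate : ∀ {m n} (p : Fin m → Bool) (f : Fin n → Fin m) →
  length (filterᵇ p (tabulate f)) ≡ count (p ∘ f)
length-filterᵇ-tabulate {n = zero}  p f = refl
length-filterᵇ-tabulate {n = suc n} p f with p (f zero)
... | true  = cong suc (trans (length-filterᵇ-tabulate p (f ∘ suc))
                              (sym (length-filterᵇ-tabulate (p ∘ f) suc)))
... | false = trans (length-filterᵇ-tabulate p (f ∘ suc))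
                    (sym (length-filterᵇ-tabulate (p ∘ f) suc))

count-suc : (p : Fin (suc n) → Bool) →
  count p ≡ (if p zero then suc (count (p ∘ suc)) else count (p ∘ suc))
count-suc p with p zero
... | true  = cong suc (length-filterᵇ-tabulate p suc)
... | false = length-filterᵇ-tabulate p suc

-- Written with does rather than ⌊_⌋ so that remove p (suc x) ∘ suc is
-- definitionally remove (p ∘ suc) x.
remove : (Fin n → Bool) → Fin n → Fin n → Bool
remove p x y = if does (y ≟ x) then false else p y

remove⁺ : (p : Fin n → Bool) {x y : Fin n} → y ≢ x → p y ≡ true → remove p x y ≡ true
remove⁺ p {x} {y} y≢x py with y ≟ x
... | yes y≡x = contradiction y≡x y≢x
... | no _    = py

remove⁻ : (p : Fin n → Bool) {x y : Fin n} → remove p x y ≡ true → y ≢ x × p y ≡ true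
remove⁻ p {x} {y} eq with y ≟ x
... | no y≢x = y≢x , eq

count-remove : (p : Fin n → Bool) {x : Fin n} → p x ≡ true → count p ≡ suc (count (remove p x))
count-remove {suc n} p {zero} px = begin
  count p
    ≡⟨ count-suc p ⟩
  (if p zero then suc (count (p ∘ suc)) else count (p ∘ suc))
    ≡⟨ cong (λ b → if b then suc (count (p ∘ suc)) else count (p ∘ suc)) px ⟩
  suc (count (p ∘ suc))
    ≡⟨ cong suc (sym (count-suc (remove p zero))) ⟩
  suc (count (remove p zero))
    ∎
  where open ≡-Reasoning
count-remove {suc n} p {suc x} px = begin
  count p
    ≡⟨ count-suc p ⟩
  (if p zero then suc (count (p ∘ suc)) else count (p ∘ suc))
    ≡⟨ cong (λ c → if p zero then suc c else c) (count-remove (p ∘ suc) px) ⟩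
  (if p zero then suc (suc r) else suc r)
    ≡⟨ sym (if-float suc (p zero)) ⟩
  suc (if p zero then suc r else r)
    ≡⟨ cong suc (sym (count-suc (remove p (suc x)))) ⟩
  suc (count (remove p (suc x)))
    ∎
  where
  open ≡-Reasoning
  r : ℕ
  r = count (remove (p ∘ suc) x)

count-witness : (p : Fin n → Bool) → 1 ≤ count p → ∃ λ x → p x ≡ true
count-witness {suc n} p 1≤count with p zero in p0
... | true  = zero , p0
... | false =
  let x , px = count-witness (p ∘ suc) (subst (1 ≤_) (length-filterᵇ-tabulate p suc) 1≤count)
  in suc x , px

count-another : (p : Fin n → Bool) {x : Fin n} → p x ≡ true → 2 ≤ count p →
  ∃ λ y → y ≢ x × p y ≡ true
count-another p px 2≤count
  with s≤s 1≤count′ ← subst (2 ≤_) (count-remove p px) 2≤count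
  with y , removed ← count-witness (remove p _) 1≤count′
  = y , remove⁻ p removed

count≥1 : (p : Fin n → Bool) {x : Fin n} → p x ≡ true → 1 ≤ count p
count≥1 p px rewrite count-remove p px = s≤s z≤n

count≥2 : (p : Fin n → Bool) {x y : Fin n} → p x ≡ true → p y ≡ true → x ≢ y → 2 ≤ count p
count≥2 p px py x≢y rewrite count-remove p px = s≤s (count≥1 (remove p _) (remove⁺ p (x≢y ∘ sym) py))

count≥3 : (p : Fin n → Bool) {x y z : Fin n} → p x ≡ true → p y ≡ true → p z ≡ true →
  x ≢ y → x ≢ z → y ≢ z → 3 ≤ count p
count≥3 p px py pz x≢y x≢z y≢z rewrite count-remove p px =
  s≤s (count≥2 (remove p _) (remove⁺ p (x≢y ∘ sym) py) (remove⁺ p (x≢z ∘ sym) pz) y≢z)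

reverse : Digraph n → Digraph n
reverse D = record { arc = λ x y → arc D y x ; loopless = loopless D }

reverse-Is22 : {D : Digraph n} → Is22 D → Is22 (reverse D)
reverse-Is22 is22 v = swap (is22 v)

module _ {D : Digraph n} (is22 : Is22 D) where

  no-three-predators : ∀ {a b c x} → arc D a x ≡ true → arc D b x ≡ true → arc D c x ≡ true →
    a ≢ b → a ≢ c → b ≢ c → ⊥
  no-three-predators {x = x} ax bx cx a≢b a≢c b≢c =
    ≤⇒≯ (proj₂ (is22 x)) (count≥3 (λ y → arc D y x) ax bx cx a≢b a≢c b≢c)

  module _ {u v w : Fin n} (u≢v : u ≢ v) (u≢w : u ≢ w) (v≢w : v ≢ w) where

    commonPrey-distinct : ∀ {x y} → commonPrey D u v x ≡ true → commonPrey D u w y ≡ true → x ≢ y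
    commonPrey-distinct uvx uwx refl = no-three-predators
      (∧-conicalˡ _ _ uvx) (∧-conicalʳ _ _ uvx) (∧-conicalʳ _ _ uwx) u≢v u≢w v≢w

    outdeg≡2 : 1 ≤ numCommonPrey D u v → 1 ≤ numCommonPrey D u w → outdeg D u ≡ 2
    outdeg≡2 uv uw
      with x , uvx ← count-witness (commonPrey D u v) uv
      with y , uwy ← count-witness (commonPrey D u w) uw
      = ≤-antisym (proj₁ (is22 u))
          (count≥2 (arc D u) (∧-conicalˡ _ _ uvx) (∧-conicalˡ _ _ uwy) (commonPrey-distinct uvx uwy))

    numCommonPrey≤1 : 1 ≤ numCommonPrey D u w → numCommonPrey D u v ≤ 1
    numCommonPrey≤1 uw = ≮⇒≥ no-second-common-prey
      where
      no-second-common-prey : ¬ 1 < numCommonPrey D u v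
      no-second-common-prey 1<uv
        with x , uvx ← count-witness (commonPrey D u v) (<⇒≤ 1<uv)
        with x′ , x′≢x , uvx′ ← count-another (commonPrey D u v) uvx 1<uv
        with z , uwz ← count-witness (commonPrey D u w) uw
        = ≤⇒≯ (proj₁ (is22 u))
            (count≥3 (arc D u) (∧-conicalˡ _ _ uvx) (∧-conicalˡ _ _ uvx′) (∧-conicalˡ _ _ uwz)
              (x′≢x ∘ sym) (commonPrey-distinct uvx uwz) (commonPrey-distinct uvx′ uwz))

    outdeg≡2×numCommonPrey≡1 : 1 ≤ numCommonPrey D u v → 1 ≤ numCommonPrey D u w →
      outdeg D u ≡ 2 × numCommonPrey D u v ≡ 1
    outdeg≡2×numCommonPrey≡1 uv uw = outdeg≡2 uv uw , ≤-antisym (numCommonPrey≤1 uw) uv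

cceAdj⁻ : (D : Digraph n) {u v : Fin n} → cceAdj D u v ≡ true →
  u ≢ v × 1 ≤ numCommonPrey D u v × 1 ≤ numCommonPred D u v
cceAdj⁻ D {u} {v} adj with u ≟ v | 1 ≤? numCommonPrey D u v | 1 ≤? numCommonPred D u v
... | no u≢v | yes prey | yes pred = u≢v , prey , pred

proposition2p2 : {n : ℕ} (D : Digraph n) → Is22 D → (u : Fin n) → cceDeg D u ≡ 2
    → (outdeg D u ≡ 2 × indeg D u ≡ 2)
      × ((v : Fin n) → cceAdj D u v ≡ true
           → numCommonPrey D u v ≡ 1 × numCommonPred D u v ≡ 1)
proposition2p2 D is22 u deg =
  map proj₁ proj₁ (bothSides (proj₂ some-neighbour)) ,
  λ v adj → map proj₂ proj₂ (bothSides adj)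
  where
  some-neighbour : ∃ λ v → cceAdj D u v ≡ true
  some-neighbour = count-witness (cceAdj D u) (subst (1 ≤_) (sym deg) (s≤s z≤n))

  bothSides : ∀ {v} → cceAdj D u v ≡ true →
    (outdeg D u ≡ 2 × numCommonPrey D u v ≡ 1) × (indeg D u ≡ 2 × numCommonPred D u v ≡ 1)
  bothSides uv
    with w , w≢v , uw ← count-another (cceAdj D u) uv (subst (2 ≤_) (sym deg) (s≤s (s≤s z≤n)))
    with u≢v , preyV , predV ← cceAdj⁻ D uv
    with u≢w , preyW , predW ← cceAdj⁻ D uw
    = outdeg≡2×numCommonPrey≡1 {D = D} is22 u≢v u≢w (w≢v ∘ sym) preyV preyW ,
      outdeg≡2×numCommonPrey≡1 {D = reverse D} (reverse-Is22 {D = D} is22) u≢v u≢w (w≢v ∘ sym) predV predW
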